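{- Let $d$ be a positive integer, let $G$ be a finite connected graph with $n$ vertices and $m$ edges, and let $A_G$ be its incidence matrix. (1) If $d$ is odd or $G$ has no cycle of odd length, then $\ker_{\mathbb{Z}_d}(A_G)=\pi_d(\ker_{\mathbb{Z}}(A_G))$. (2) If $d$ is even and $C'$ is a cycle of odd length in $G$, then $\ker_{\mathbb{Z}_d}(A_G)=\pi_d(\ker_{\mathbb{Z}}(A_G))\oplus\langle\pi_d(\omega_{C'})\rangle$.
   Context: The incidence matrix $A_G\in\mathbb{Z}^{n\times m}$ has $(i,j)$ entry $1$ if vertex $v_i$ is incident with edge $e_j$, $0$ otherwise. $\ker_{\mathbb{Z}}(A_G)=\{x\in\mathbb{Z}^m:A_Gx=0\}$, $\ker_{\mathbb{Z}_d}(A_G)=\{x\in\mathbb{Z}_d^m:A_Gx\equiv0\pmod d\}$, and $\pi_d:\mathbb{Z}^m\to\mathbb{Z}_d^m$ is coordinatewise reduction mod $d$; $\langle\cdot\rangle$ denotes the generated subgroup. A cycle of length $k$ is a closed walk (not necessarily simple) with consecutive edges $e_1,\dots,e_k$, $e_i=(v_i,v_{i+1})$ for $i<k$, $e_k=(v_k,v_1)$. For $d$ even and a cycle $C'$ of odd length with edges $e_1,\dots,e_k$, $\omega_{C'}\in\mathbb{Z}^m$ is the vector whose coordinate at an edge $e$ of $G$ is $\frac d2$ times the number of occurrences of $e$ among $e_1,\dots,e_k$. -}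

module Defs where

open import Data.Nat as ℕ using (ℕ; zero; suc; NonZero)
open import Data.Nat.DivMod using (_%_; m%n<n)
open import Data.Nat.Divisibility using () renaming (_∣_ to _∣ℕ_)
open import Data.Integer as ℤ using (ℤ; +_; _%ℕ_)
open import Data.Integer.DivMod using (n%ℕd<d)
open import Data.Integer.Divisibility using (_∣_)
open import Data.Fin as Fin using (Fin; toℕ; fromℕ<)
open import Data.Fin.Properties using () renaming (_≟_ to _≟ᶠ_)
open import Data.List using (List; []; _∷_; length)
open import Data.Product using (Σ; _×_; _,_; proj₁; proj₂; ∃)
open import Data.Sum using (_⊎_)
open import Data.Bool using (if_then_else_; _∨_)
open import Relation.Nullary using (¬_; does)
open import Relation.Binary.PropositionalEquality using (_≡_; _≢_)

record Graph (n m : ℕ) : Set where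
  field
    ends     : Fin m → Fin n × Fin n
    loopless : ∀ e → proj₁ (ends e) ≢ proj₂ (ends e)
    simple   : ∀ e f → (ends e ≡ ends f
                          ⊎ (proj₁ (ends e) ≡ proj₂ (ends f) × proj₂ (ends e) ≡ proj₁ (ends f)))
                     → e ≡ f
open Graph public

module _ {n m : ℕ} (G : Graph n m) where

  Joins : Fin m → Fin n → Fin n → Set
  Joins e u w = ends G e ≡ (u , w) ⊎ ends G e ≡ (w , u)

  data Walk : Fin n → Fin n → Set where
    []  : ∀ {u} → Walk u u
    _∷_ : ∀ {u w v} → (Σ (Fin m) λ e → Joins e u w) → Walk w v → Walk u v

  edges : ∀ {u v} → Walk u v → List (Fin m)
  edges []             = []
  edges ((e , _) ∷ p)  = e ∷ edges p

  walkLength : ∀ {u v} → Walk u v → ℕ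
  walkLength p = length (edges p)

  Connected : Set
  Connected = ∀ u v → Walk u v

  -- a cycle (closed walk, not necessarily simple) of odd length
  OddCycle : Set
  OddCycle = Σ (Fin n) λ v → Σ (Walk v v) λ C → ¬ (2 ∣ℕ walkLength C)

  incidence : Fin n → Fin m → ℤ
  incidence i j =
    if does (i ≟ᶠ proj₁ (ends G j)) ∨ does (i ≟ᶠ proj₂ (ends G j)) then + 1 else + 0

count : ∀ {m} → Fin m → List (Fin m) → ℕ
count e []       = zero
count e (f ∷ fs) = if does (e ≟ᶠ f) then suc (count e fs) else count e fs

sumℤ : ∀ {m} → (Fin m → ℤ) → ℤ
sumℤ {zero}  f = + 0
sumℤ {suc m} f = f Fin.zero ℤ.+ sumℤ (λ j → f (Fin.suc j))

module _ {n m : ℕ} (G : Graph n m) where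

  Ax : (Fin m → ℤ) → Fin n → ℤ
  Ax x i = sumℤ (λ j → incidence G i j ℤ.* x j)

  InKerℤ : (Fin m → ℤ) → Set
  InKerℤ x = ∀ i → Ax x i ≡ + 0

  InKerMod : (d : ℕ) → (Fin m → Fin d) → Set
  InKerMod d y = ∀ i → (+ d) ∣ Ax (λ j → + toℕ (y j)) i

  ω : (d : ℕ) → ∀ {v} → Walk G v v → Fin m → ℤ
  ω d C e = + (d ℕ./ 2) ℤ.* + count e (edges G C)

πd : (d : ℕ) .{{_ : NonZero d}} → ℤ → Fin d
πd d z = fromℕ< (n%ℕd<d z d)

addMod : (d : ℕ) .{{_ : NonZero d}} → Fin d → Fin d → Fin d
addMod d a b = πd d (+ toℕ a ℤ.+ + toℕ b)

smulMod : (d : ℕ) .{{_ : NonZero d}} → ℤ → Fin d → Fin d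
smulMod d c a = πd d (c ℤ.* + toℕ a)

zeroMod : (d : ℕ) .{{_ : NonZero d}} → Fin d
zeroMod d = πd d (+ 0)

module Submission where

-- Fix a root r; the alternating vector e₁ - e₂ + e₃ - …
-- of a walk u ⇝ r is mapped to δ_u ± δ_r.  If G has an odd closed walk at r, every b with even
-- coordinate sum is in the image; otherwise parity of walks to r is a proper 2-colouring, and
-- every b orthogonal to the ±1 colours is in the image.
--
-- Lifting (module Kernels): y ∈ ker_{ℤ_d} means A ŷ = d·b; if A w = b then ŷ - d·w ∈ ker_ℤ
-- reduces to y.  The condition on b follows by summing coordinates, except for d even and G
-- non-bipartite, where Σ b may be odd and we first subtract ω (A ω = d·visits, Σ visits odd).
-- The sum is direct because Σ_j x_j = 0 on ker_ℤ while Σ_j ω_j = (d/2)·odd ≢ 0 (mod d).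
open import Defs
open import Data.Nat using (ℕ; NonZero)
open import Data.Nat.Divisibility using (_∣_)
open import Data.Integer using (ℤ)
open import Data.Fin using (Fin)
open import Data.Product using (Σ; _×_; _,_)
open import Data.Sum using (_⊎_)
open import Relation.Nullary using (¬_)
open import Relation.Binary.PropositionalEquality using (_≡_)
open import Function.Bundles using (_⇔_)

open import Data.Nat as ℕ using (zero; suc)
import Data.Nat.Properties as ℕP
import Data.Nat.Divisibility as ℕD
import Data.Nat.DivMod as ℕDM
open import Data.Integer as ℤ using (+_; _+_; _*_; -_; _-_; 0ℤ; 1ℤ)
import Data.Integer.Properties as ℤP
import Data.Integer.Divisibility as ℤU
import Data.Integer.Divisibility.Signed as ℤD
open import Data.Integer.DivMod using (a≡a%ℕn+[a/ℕn]*n; n%ℕd<d)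
open import Data.Integer.Tactic.RingSolver using (solve-∀)
open import Data.Fin as Fin using (toℕ)
import Data.Fin.Properties as FinP
open import Data.Fin.Properties using () renaming (_≟_ to _≟ᶠ_)
open import Data.Bool using (Bool; true; false; not; _xor_; if_then_else_)
import Data.Bool.Properties as BoolP
open import Data.Empty using (⊥; ⊥-elim)
open import Data.Product using (proj₁; proj₂)
open import Data.Sum using (inj₁; inj₂)
open import Data.List as List using (List)
open import Function.Bundles using (mk⇔)
open import Relation.Nullary using (does; yes; no)
open import Relation.Binary.PropositionalEquality
  using (refl; sym; trans; cong; cong₂; subst; _≢_; module ≡-Reasoning)
open import Algebra.Properties.Semiring.Sum ℤP.+-*-semiring
  using (sum; sum-cong-≗; ∑-distrib-+; ∑-comm; *-distribˡ-sum; sum-replicate-zero)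

open ≡-Reasoning

sumℤ≡sum : ∀ {k} (f : Fin k → ℤ) → sumℤ f ≡ sum f
sumℤ≡sum {zero}  f = refl
sumℤ≡sum {suc k} f = cong (_+_ (f Fin.zero)) (sumℤ≡sum (λ j → f (Fin.suc j)))

sum-cong : ∀ {k} {f g : Fin k → ℤ} → (∀ j → f j ≡ g j) → sumℤ f ≡ sumℤ g
sum-cong {f = f} {g} f≗g = trans (sumℤ≡sum f) (trans (sum-cong-≗ f≗g) (sym (sumℤ≡sum g)))

sum-+ : ∀ {k} (f g : Fin k → ℤ) → sumℤ (λ j → f j + g j) ≡ sumℤ f + sumℤ g
sum-+ f g = trans (sumℤ≡sum (λ j → f j + g j))
  (trans (∑-distrib-+ f g) (sym (cong₂ _+_ (sumℤ≡sum f) (sumℤ≡sum g))))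

sum-scale : ∀ {k} (c : ℤ) (f : Fin k → ℤ) → sumℤ (λ j → c * f j) ≡ c * sumℤ f
sum-scale c f = trans (sumℤ≡sum (λ j → c * f j))
  (trans (sym (*-distribˡ-sum c f)) (cong (c *_) (sym (sumℤ≡sum f))))

sum-zero : ∀ {k} → sumℤ {k} (λ _ → 0ℤ) ≡ 0ℤ
sum-zero {k} = trans (sumℤ≡sum {k} (λ _ → 0ℤ)) (sum-replicate-zero k)

sum-− : ∀ {k} (f g : Fin k → ℤ) → sumℤ (λ j → f j - g j) ≡ sumℤ f - sumℤ g
sum-− f g = begin
  sumℤ (λ j → f j - g j)           ≡⟨ sum-+ f (λ j → - g j) ⟩
  sumℤ f + sumℤ (λ j → - g j)
    ≡⟨ cong (_+_ (sumℤ f)) (sum-cong (λ j → sym (ℤP.-1*i≡-i (g j)))) ⟩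
  sumℤ f + sumℤ (λ j → - 1ℤ * g j)
    ≡⟨ cong (_+_ (sumℤ f)) (trans (sum-scale (- 1ℤ) g) (ℤP.-1*i≡-i _)) ⟩
  sumℤ f - sumℤ g                  ∎

sum-swap : ∀ {k l} (f : Fin k → Fin l → ℤ) →
  sumℤ (λ i → sumℤ (f i)) ≡ sumℤ (λ j → sumℤ (λ i → f i j))
sum-swap f = begin
  sumℤ (λ i → sumℤ (f i))          ≡⟨ sumℤ≡sum (λ i → sumℤ (f i)) ⟩
  sum (λ i → sumℤ (f i))           ≡⟨ sum-cong-≗ (λ i → sumℤ≡sum (f i)) ⟩
  sum (λ i → sum (f i))            ≡⟨ ∑-comm f ⟩
  sum (λ j → sum (λ i → f i j))    ≡⟨ sum-cong-≗ (λ j → sym (sumℤ≡sum (λ i → f i j))) ⟩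
  sum (λ j → sumℤ (λ i → f i j))   ≡⟨ sym (sumℤ≡sum (λ j → sumℤ (λ i → f i j))) ⟩
  sumℤ (λ j → sumℤ (λ i → f i j))  ∎

δ : ∀ {k} → Fin k → Fin k → ℤ
δ a b = if does (a ≟ᶠ b) then + 1 else + 0

δ-suc : ∀ {k} (a b : Fin k) → δ (Fin.suc a) (Fin.suc b) ≡ δ a b
δ-suc a b with a ≟ᶠ b
... | yes _ = refl
... | no _  = refl

δ-sym : ∀ {k} (a b : Fin k) → δ a b ≡ δ b a
δ-sym a b with a ≟ᶠ b | b ≟ᶠ a
... | yes _ | yes _ = refl
... | no _  | no _  = refl
... | yes p | no q  = ⊥-elim (q (sym p))
... | no p  | yes q = ⊥-elim (p (sym q))

sum-δ : ∀ {k} (f : Fin k → ℤ) (e : Fin k) → sumℤ (λ j → f j * δ j e) ≡ f e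
sum-δ {suc k} f Fin.zero = begin
  f Fin.zero * + 1 + sumℤ (λ j → f (Fin.suc j) * + 0)
    ≡⟨ cong₂ _+_ (ℤP.*-identityʳ (f Fin.zero))
                 (trans (sum-cong (λ j → ℤP.*-zeroʳ (f (Fin.suc j)))) (sum-zero {k})) ⟩
  f Fin.zero + 0ℤ                ≡⟨ ℤP.+-identityʳ (f Fin.zero) ⟩
  f Fin.zero                     ∎
sum-δ {suc k} f (Fin.suc e) = begin
  f Fin.zero * + 0 + sumℤ (λ j → f (Fin.suc j) * δ (Fin.suc j) (Fin.suc e))
    ≡⟨ cong₂ _+_ (ℤP.*-zeroʳ (f Fin.zero)) (sum-cong (λ j → cong (f (Fin.suc j) *_) (δ-suc j e))) ⟩
  0ℤ + sumℤ (λ j → f (Fin.suc j) * δ j e)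
    ≡⟨ trans (ℤP.+-identityˡ (sumℤ (λ j → f (Fin.suc j) * δ j e))) (sum-δ (λ j → f (Fin.suc j)) e) ⟩
  f (Fin.suc e)                  ∎

even+2 : ∀ {k} → 2 ∣ k → 2 ∣ suc (suc k)
even+2 {k} k-even = subst (2 ∣_) (ℕP.+-comm k 2) (ℕD.∣m∣n⇒∣m+n k-even ℕD.∣-refl)

even-or-odd : ∀ k → 2 ∣ k ⊎ 2 ∣ suc k
even-or-odd zero = inj₁ (ℕD._∣0 2)
even-or-odd (suc k) with even-or-odd k
... | inj₁ k-even   = inj₂ (even+2 k-even)
... | inj₂ k+1-even = inj₁ k+1-even

not-even-twice : ∀ k → 2 ∣ k → ¬ 2 ∣ suc k
not-even-twice k k-even k+1-even
  with ℕD.∣1⇒≡1 (ℕD.∣m+n∣m⇒∣n (subst (2 ∣_) (ℕP.+-comm 1 k) k+1-even) k-even)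
... | ()

odd-ℕ : ∀ k → ¬ 2 ∣ k → Σ ℕ λ l → + k ≡ + 2 * + l + + 1
odd-ℕ zero k-odd = ⊥-elim (k-odd (ℕD._∣0 2))
odd-ℕ (suc zero) _ = 0 , refl
odd-ℕ (suc (suc k)) k+2-odd with odd-ℕ k (λ k-even → k+2-odd (even+2 k-even))
... | l , k≡2l+1 = suc l , trans (cong (λ t → + 2 + t) k≡2l+1) (shift (+ l))
  where shift : ∀ t → + 2 + (+ 2 * t + + 1) ≡ + 2 * (+ 1 + t) + + 1
        shift = solve-∀

ℤ-parity : ∀ (s : ℤ) → Σ ℤ (λ k → s ≡ + 2 * k) ⊎ Σ ℤ (λ k → s ≡ + 2 * k + + 1)
ℤ-parity s = by-remainder (s ℤ.%ℕ 2) (n%ℕd<d s 2) (a≡a%ℕn+[a/ℕn]*n s 2)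
  where
  by-remainder : ∀ ρ → ρ ℕ.< 2 → s ≡ + ρ + (s ℤ./ℕ 2) * + 2 →
                 Σ ℤ (λ k → s ≡ + 2 * k) ⊎ Σ ℤ (λ k → s ≡ + 2 * k + + 1)
  by-remainder 0 _ e = inj₁ (s ℤ./ℕ 2 , trans e (norm (s ℤ./ℕ 2)))
    where norm : ∀ q → + 0 + q * + 2 ≡ + 2 * q
          norm = solve-∀
  by-remainder 1 _ e = inj₂ (s ℤ./ℕ 2 , trans e (norm (s ℤ./ℕ 2)))
    where norm : ∀ q → + 1 + q * + 2 ≡ + 2 * q + + 1
          norm = solve-∀
  by-remainder (suc (suc _)) (ℕ.s≤s (ℕ.s≤s ())) _

odd≢even : ∀ k l → + 2 * k + + 1 ≢ + 2 * l
odd≢even k l odd≡even = 1≢2t ℤ.∣ l - k ∣ (trans (cong ℤ.∣_∣ 1≡2[l-k]) (ℤP.abs-* (+ 2) (l - k)))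
  where
  1≢2t : ∀ t → 1 ≢ 2 ℕ.* t
  1≢2t zero ()
  1≢2t (suc t) e with trans (cong ℕ.pred e) (ℕP.+-suc t (t ℕ.+ 0))
  ... | ()
  isolate : ∀ k → + 1 ≡ (+ 2 * k + + 1) - + 2 * k
  isolate = solve-∀
  factor : ∀ k l → + 2 * l - + 2 * k ≡ + 2 * (l - k)
  factor = solve-∀
  1≡2[l-k] : + 1 ≡ + 2 * (l - k)
  1≡2[l-k] = trans (isolate k) (trans (cong (λ t → t - + 2 * k) odd≡even) (factor k l))

even-factor : ∀ {d} → ¬ 2 ∣ d → ∀ s t → s * + d ≡ + 2 * t → Σ ℤ λ k → s ≡ + 2 * k
even-factor {d} d-odd s t sd≡2t with ℤ-parity s | odd-ℕ d d-odd
... | inj₁ s-even | _ = s-even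
... | inj₂ (k , s≡2k+1) | e , d≡2e+1 = ⊥-elim (odd≢even (+ 2 * k * + e + k + + e) t
      (trans (expand k (+ e)) (trans (cong₂ _*_ (sym s≡2k+1) (sym d≡2e+1)) sd≡2t)))
  where expand : ∀ k e → + 2 * (+ 2 * k * e + k + e) + + 1 ≡ (+ 2 * k + + 1) * (+ 2 * e + + 1)
        expand = solve-∀

infix 4 _≡[_]_
record _≡[_]_ (a : ℤ) (d : ℕ) (b : ℤ) : Set where
  constructor _,_
  field
    quo : ℤ
    prf : a - b ≡ quo * + d
open _≡[_]_ public

cg-refl : ∀ {d} a → a ≡[ d ] a
cg-refl {d} a = 0ℤ , trans (ℤP.+-inverseʳ a) (sym (ℤP.*-zeroˡ (+ d)))

cg-eq : ∀ {d a b} → a ≡ b → a ≡[ d ] b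
cg-eq {a = a} refl = cg-refl a

cg-sym : ∀ {d a b} → a ≡[ d ] b → b ≡[ d ] a
cg-sym {d} {a} {b} (q , e) = - q , trans (flip a b) (trans (cong -_ e) (ℤP.neg-distribˡ-* q (+ d)))
  where flip : ∀ x y → y - x ≡ - (x - y)
        flip = solve-∀

cg-trans : ∀ {d a b c} → a ≡[ d ] b → b ≡[ d ] c → a ≡[ d ] c
cg-trans {d} {a} {b} {c} (q , e) (q' , e') = q + q' ,
  trans (split a b c) (trans (cong₂ _+_ e e') (sym (ℤP.*-distribʳ-+ (+ d) q q')))
  where split : ∀ x y z → x - z ≡ (x - y) + (y - z)
        split = solve-∀

cg-+ : ∀ {d a b c e} → a ≡[ d ] b → c ≡[ d ] e → (a + c) ≡[ d ] (b + e)
cg-+ {d} {a} {b} {c} {e} (q , h) (q' , h') = q + q' ,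
  trans (regroup a b c e) (trans (cong₂ _+_ h h') (sym (ℤP.*-distribʳ-+ (+ d) q q')))
  where regroup : ∀ x y z w → x + z - (y + w) ≡ (x - y) + (z - w)
        regroup = solve-∀

cg-* : ∀ {d a b} (c : ℤ) → a ≡[ d ] b → (c * a) ≡[ d ] (c * b)
cg-* {d} {a} {b} c (q , h) = c * q ,
  trans (factor c a b) (trans (cong (c *_) h) (sym (ℤP.*-assoc c q (+ d))))
  where factor : ∀ x y z → x * y - x * z ≡ x * (y - z)
        factor = solve-∀

cg-sum : ∀ {d k} (f g : Fin k → ℤ) → (∀ j → f j ≡[ d ] g j) → sumℤ f ≡[ d ] sumℤ g
cg-sum {d} {zero}  f g f≡g = cg-refl (+ 0)
cg-sum {d} {suc k} f g f≡g =
  cg-+ (f≡g Fin.zero) (cg-sum (λ j → f (Fin.suc j)) (λ j → g (Fin.suc j)) (λ j → f≡g (Fin.suc j)))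

residue-unique : ∀ {ρ₁ ρ₂ d} (t : ℤ) → ρ₁ ℕ.< d → ρ₂ ℕ.< d →
  + ρ₁ - + ρ₂ ≡ t * + d → ρ₁ ≡ ρ₂
residue-unique {ρ₁} {ρ₂} {d} t ρ₁<d ρ₂<d e =
  ℤP.+-injective (ℤP.i-j≡0⇒i≡j (+ ρ₁) (+ ρ₂)
    (ℤP.∣i∣≡0⇒i≡0 (small-multiple ℤ.∣ t ∣ gap<d gap≡)))
  where
  small-multiple : ∀ {x} k → x ℕ.< d → x ≡ k ℕ.* d → x ≡ 0
  small-multiple zero _ x≡0 = x≡0
  small-multiple (suc k) x<d x≡ = ⊥-elim (ℕP.<-irrefl refl
    (ℕP.<-≤-trans x<d (subst (d ℕ.≤_) (sym x≡) (ℕP.m≤m+n d (k ℕ.* d)))))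
  gap<d : ℤ.∣ + ρ₁ - + ρ₂ ∣ ℕ.< d
  gap<d = subst (ℕ._< d) (cong ℤ.∣_∣ (sym (ℤP.m-n≡m⊖n ρ₁ ρ₂)))
            (ℕP.≤-<-trans (ℤP.∣m⊝n∣≤m⊔n ρ₁ ρ₂) (ℕP.⊔-lub ρ₁<d ρ₂<d))
  gap≡ : ℤ.∣ + ρ₁ - + ρ₂ ∣ ≡ ℤ.∣ t ∣ ℕ.* d
  gap≡ = trans (cong ℤ.∣_∣ e) (ℤP.abs-* t (+ d))

module Reduction (d : ℕ) .{{_ : NonZero d}} where

  lift-reduce : ∀ a → + toℕ (πd d a) ≡[ d ] a
  lift-reduce a = cg-sym (subst (λ t → a ≡[ d ] t) (cong +_ (sym (FinP.toℕ-fromℕ< (n%ℕd<d a d))))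
    (subst (λ t → t ≡[ d ] + (a ℤ.%ℕ d)) (sym (a≡a%ℕn+[a/ℕn]*n a d))
      (a ℤ./ℕ d , norm (+ (a ℤ.%ℕ d)) (a ℤ./ℕ d) (+ d))))
    where norm : ∀ x y z → x + y * z - x ≡ y * z
          norm = solve-∀

  reduce-cong : ∀ {a b} → a ≡[ d ] b → πd d a ≡ πd d b
  reduce-cong {a} {b} a≡b = FinP.toℕ-injective
    (residue-unique (quo c) (FinP.toℕ<n (πd d a)) (FinP.toℕ<n (πd d b)) (prf c))
    where c = cg-trans (lift-reduce a) (cg-trans a≡b (cg-sym (lift-reduce b)))

  reduce-lift : ∀ (y : Fin d) → πd d (+ toℕ y) ≡ y
  reduce-lift y = FinP.toℕ-injective
    (trans (FinP.toℕ-fromℕ< (n%ℕd<d (+ toℕ y) d)) (ℕDM.m<n⇒m%n≡m (FinP.toℕ<n y)))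

  reduce-to : ∀ {a} {y : Fin d} → a ≡[ d ] + toℕ y → πd d a ≡ y
  reduce-to a≡y = trans (reduce-cong a≡y) (reduce-lift _)

  reduce-from : ∀ {a} {y : Fin d} → πd d a ≡ y → + toℕ y ≡[ d ] a
  reduce-from refl = lift-reduce _

  reduce-affine : ∀ a c e → addMod d (πd d a) (smulMod d c (πd d e)) ≡ πd d (a + c * e)
  reduce-affine a c e = reduce-cong (cg-+ (lift-reduce a)
    (cg-trans (lift-reduce (c * + toℕ (πd d e))) (cg-* c (lift-reduce e))))

  reduce-scale : ∀ c e → smulMod d c (πd d e) ≡ πd d (c * e)
  reduce-scale c e = reduce-cong (cg-* c (lift-reduce e))

module Incidence {n m : ℕ} (G : Graph n m) where

  src tgt : Fin m → Fin n
  src j = proj₁ (ends G j)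
  tgt j = proj₂ (ends G j)

  -- Column j of A is δ_src + δ_tgt (the graph is loopless).
  incidence-δ : ∀ i j → incidence G i j ≡ δ i (src j) + δ i (tgt j)
  incidence-δ i j with i ≟ᶠ src j | i ≟ᶠ tgt j
  ... | yes p | yes q = ⊥-elim (loopless G j (trans (sym p) q))
  ... | yes _ | no _  = refl
  ... | no _  | yes _ = refl
  ... | no _  | no _  = refl

  incidence-joins : ∀ {e u w} → Joins G e u w → ∀ i → incidence G i e ≡ δ i u + δ i w
  incidence-joins {e} (inj₁ e≡uw) i =
    trans (incidence-δ i e) (cong (λ p → δ i (proj₁ p) + δ i (proj₂ p)) e≡uw)
  incidence-joins {e} {u} {w} (inj₂ e≡wu) i =
    trans (incidence-δ i e) (trans (cong (λ p → δ i (proj₁ p) + δ i (proj₂ p)) e≡wu)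
                                   (ℤP.+-comm (δ i w) (δ i u)))

  Solvable : (Fin n → ℤ) → Set
  Solvable b = Σ (Fin m → ℤ) λ w → ∀ i → Ax G w i ≡ b i

  Ax-cong : ∀ {f g : Fin m → ℤ} → (∀ j → f j ≡ g j) → ∀ i → Ax G f i ≡ Ax G g i
  Ax-cong f≗g i = sum-cong (λ j → cong (incidence G i j *_) (f≗g j))

  Ax-+ : ∀ (f g : Fin m → ℤ) i → Ax G (λ j → f j + g j) i ≡ Ax G f i + Ax G g i
  Ax-+ f g i = trans (sum-cong (λ j → ℤP.*-distribˡ-+ (incidence G i j) (f j) (g j)))
                     (sum-+ (λ j → incidence G i j * f j) (λ j → incidence G i j * g j))

  Ax-scale : ∀ (c : ℤ) (f : Fin m → ℤ) i → Ax G (λ j → c * f j) i ≡ c * Ax G f i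
  Ax-scale c f i = trans (sum-cong (λ j → swap (incidence G i j) c (f j)))
                         (sum-scale c (λ j → incidence G i j * f j))
    where swap : ∀ x y z → x * (y * z) ≡ y * (x * z)
          swap = solve-∀

  Ax-− : ∀ (f g : Fin m → ℤ) i → Ax G (λ j → f j - g j) i ≡ Ax G f i - Ax G g i
  Ax-− f g i = begin
    Ax G (λ j → f j - g j) i           ≡⟨ Ax-+ f (λ j → - g j) i ⟩
    Ax G f i + Ax G (λ j → - g j) i
      ≡⟨ cong (_+_ (Ax G f i)) (Ax-cong (λ j → sym (ℤP.-1*i≡-i (g j))) i) ⟩
    Ax G f i + Ax G (λ j → - 1ℤ * g j) i
      ≡⟨ cong (_+_ (Ax G f i)) (trans (Ax-scale (- 1ℤ) g i) (ℤP.-1*i≡-i _)) ⟩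
    Ax G f i - Ax G g i                ∎

  Ax-zero : ∀ i → Ax G (λ _ → 0ℤ) i ≡ 0ℤ
  Ax-zero i = trans (sum-cong (λ j → ℤP.*-zeroʳ (incidence G i j))) (sum-zero {m})

  Ax-unit : ∀ e i → Ax G (λ j → δ j e) i ≡ incidence G i e
  Ax-unit e i = sum-δ (incidence G i) e

  Ax-sum : ∀ {k} (F : Fin k → Fin m → ℤ) i →
    Ax G (λ j → sumℤ (λ u → F u j)) i ≡ sumℤ (λ u → Ax G (F u) i)
  Ax-sum F i = trans (sum-cong (λ j → sym (sum-scale (incidence G i j) (λ u → F u j))))
                     (sum-swap (λ j u → incidence G i j * F u j))

  Ax-dual : ∀ (h : Fin n → ℤ) (z : Fin m → ℤ) →
    sumℤ (λ u → h u * Ax G z u) ≡ sumℤ (λ j → z j * (h (src j) + h (tgt j)))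
  Ax-dual h z = begin
    sumℤ (λ u → h u * Ax G z u)
      ≡⟨ sum-cong (λ u → sym (sum-scale (h u) (λ j → incidence G u j * z j))) ⟩
    sumℤ (λ u → sumℤ (λ j → h u * (incidence G u j * z j)))
      ≡⟨ sum-swap (λ u j → h u * (incidence G u j * z j)) ⟩
    sumℤ (λ j → sumℤ (λ u → h u * (incidence G u j * z j)))
      ≡⟨ sum-cong column ⟩
    sumℤ (λ j → z j * (h (src j) + h (tgt j))) ∎
    where
    spread : ∀ x a b z → x * ((a + b) * z) ≡ z * (x * a + x * b)
    spread = solve-∀
    column : ∀ j → sumℤ (λ u → h u * (incidence G u j * z j)) ≡ z j * (h (src j) + h (tgt j))
    column j = begin
      sumℤ (λ u → h u * (incidence G u j * z j))
        ≡⟨ sum-cong (λ u → trans (cong (λ t → h u * (t * z j)) (incidence-δ u j))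
                                 (spread (h u) (δ u (src j)) (δ u (tgt j)) (z j))) ⟩
      sumℤ (λ u → z j * (h u * δ u (src j) + h u * δ u (tgt j)))
        ≡⟨ sum-scale (z j) (λ u → h u * δ u (src j) + h u * δ u (tgt j)) ⟩
      z j * sumℤ (λ u → h u * δ u (src j) + h u * δ u (tgt j))
        ≡⟨ cong (z j *_) (trans (sum-+ (λ u → h u * δ u (src j)) (λ u → h u * δ u (tgt j)))
                                 (cong₂ _+_ (sum-δ h (src j)) (sum-δ h (tgt j)))) ⟩
      z j * (h (src j) + h (tgt j)) ∎

  -- Every edge has two ends: Σ_i (A z)_i = 2 Σ_j z_j.
  sum-Ax : ∀ z → sumℤ (Ax G z) ≡ + 2 * sumℤ z
  sum-Ax z = begin
    sumℤ (Ax G z)                       ≡⟨ sum-cong (λ u → sym (ℤP.*-identityˡ (Ax G z u))) ⟩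
    sumℤ (λ u → + 1 * Ax G z u)         ≡⟨ Ax-dual (λ _ → + 1) z ⟩
    sumℤ (λ j → z j * + 2)              ≡⟨ sum-cong (λ j → ℤP.*-comm (z j) (+ 2)) ⟩
    sumℤ (λ j → + 2 * z j)              ≡⟨ sum-scale (+ 2) z ⟩
    + 2 * sumℤ z                        ∎

  sum-kernel : ∀ x → InKerℤ G x → sumℤ x ≡ 0ℤ
  sum-kernel x Ax≡0 = ℤP.*-cancelˡ-≡ (+ 2) (sumℤ x) 0ℤ
    (trans (sym (sum-Ax x)) (trans (sum-cong Ax≡0) (trans (sum-zero {n}) (sym (ℤP.*-zeroʳ (+ 2))))))

sign : Bool → ℤ
sign false = + 1
sign true  = - (+ 1)

module Walks {n m : ℕ} (G : Graph n m) where
  open Incidence G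

  parity : ∀ {u v} → Walk G u v → Bool
  parity []      = false
  parity (_ ∷ p) = not (parity p)

  parity-length : ∀ {u v} (p : Walk G u v) →
    (parity p ≡ false × 2 ∣ walkLength G p) ⊎ (parity p ≡ true × ¬ 2 ∣ walkLength G p)
  parity-length [] = inj₁ (refl , ℕD._∣0 2)
  parity-length (_ ∷ p) with parity p | parity-length p
  ... | .false | inj₁ (refl , p-even) = inj₂ (refl , not-even-twice _ p-even)
  ... | .true  | inj₂ (refl , p-odd) with even-or-odd (walkLength G p)
  ...   | inj₁ p-even = ⊥-elim (p-odd p-even)
  ...   | inj₂ p+1-even = inj₁ (refl , p+1-even)

  odd⇒parity : ∀ {u v} (p : Walk G u v) → ¬ 2 ∣ walkLength G p → parity p ≡ true
  odd⇒parity p p-odd with parity-length p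
  ... | inj₁ (_ , p-even) = ⊥-elim (p-odd p-even)
  ... | inj₂ (p-true , _) = p-true

  parity⇒odd : ∀ {u v} (p : Walk G u v) → parity p ≡ true → ¬ 2 ∣ walkLength G p
  parity⇒odd p p-true with parity-length p
  ... | inj₂ (_ , p-odd) = p-odd
  ... | inj₁ (p-false , _) with trans (sym p-true) p-false
  ...   | ()

  infixr 5 _++w_
  _++w_ : ∀ {u v w} → Walk G u v → Walk G v w → Walk G u w
  []      ++w q = q
  (x ∷ p) ++w q = x ∷ (p ++w q)

  parity-++ : ∀ {u v w} (p : Walk G u v) (q : Walk G v w) → parity (p ++w q) ≡ parity p xor parity q
  parity-++ []      q = refl
  parity-++ (_ ∷ p) q = trans (cong not (parity-++ p q)) (BoolP.not-distribˡ-xor (parity p) (parity q))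

  flip-joins : ∀ {e u w} → Joins G e u w → Joins G e w u
  flip-joins (inj₁ uw) = inj₂ uw
  flip-joins (inj₂ wu) = inj₁ wu

  reverse : ∀ {u v} → Walk G u v → Walk G v u
  reverse []            = []
  reverse ((e , j) ∷ p) = reverse p ++w ((e , flip-joins j) ∷ [])

  parity-reverse : ∀ {u v} (p : Walk G u v) → parity (reverse p) ≡ parity p
  parity-reverse []            = refl
  parity-reverse ((e , j) ∷ p) = trans (parity-++ (reverse p) ((e , flip-joins j) ∷ []))
    (trans (BoolP.xor-comm (parity (reverse p)) true) (cong not (parity-reverse p)))

  alternating : ∀ {u v} → Walk G u v → Fin m → ℤ
  alternating []            j = 0ℤ
  alternating ((e , _) ∷ p) j = δ j e - alternating p j

  Ax-alternating : ∀ {u v} (p : Walk G u v) i →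
    Ax G (alternating p) i ≡ δ i u - sign (parity p) * δ i v
  Ax-alternating {u} [] i = trans (Ax-zero i) (cancel (δ i u))
    where cancel : ∀ x → 0ℤ ≡ x - + 1 * x
          cancel = solve-∀
  Ax-alternating {u} {v} (_∷_ {w = w} (e , joins) p) i = begin
    Ax G (λ j → δ j e - alternating p j) i
      ≡⟨ Ax-− (λ j → δ j e) (alternating p) i ⟩
    Ax G (λ j → δ j e) i - Ax G (alternating p) i
      ≡⟨ cong₂ _-_ (trans (Ax-unit e i) (incidence-joins joins i)) (Ax-alternating p i) ⟩
    δ i u + δ i w - (δ i w - sign (parity p) * δ i v)
      ≡⟨ telescope (δ i u) (δ i w) (sign (parity p)) (δ i v) ⟩
    δ i u - (- sign (parity p)) * δ i v
      ≡⟨ cong (λ s → δ i u - s * δ i v) (sym (sign-not (parity p))) ⟩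
    δ i u - sign (not (parity p)) * δ i v ∎
    where
    telescope : ∀ x y s z → x + y - (y - s * z) ≡ x - (- s) * z
    telescope = solve-∀
    sign-not : ∀ b → sign (not b) ≡ - sign b
    sign-not false = refl
    sign-not true  = refl

  occurrences : ∀ {u v} → Walk G u v → Fin m → ℤ
  occurrences p j = + count j (edges G p)

  -- Visits strictly inside a walk (the empty walk gets -δ_u, making Ax-occurrences uniform).
  inner : ∀ {u v} → Walk G u v → Fin n → ℤ
  inner {u} []                  i = - δ i u
  inner (_∷_ {w = w} _ p) i = δ i w + inner p i

  count-step : ∀ {k} (j e : Fin k) (l : List (Fin k)) → + count j (e List.∷ l) ≡ δ j e + + count j l
  count-step j e l with j ≟ᶠ e
  ... | yes _ = refl
  ... | no _  = refl

  Ax-occurrences : ∀ {u v} (p : Walk G u v) i →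
    Ax G (occurrences p) i ≡ δ i u + δ i v + + 2 * inner p i
  Ax-occurrences {u} [] i = trans (Ax-zero i) (cancel (δ i u))
    where cancel : ∀ x → 0ℤ ≡ x + x + + 2 * (- x)
          cancel = solve-∀
  Ax-occurrences {u} {v} (_∷_ {w = w} (e , joins) p) i = begin
    Ax G (occurrences ((e , joins) ∷ p)) i
      ≡⟨ Ax-cong (λ j → count-step j e (edges G p)) i ⟩
    Ax G (λ j → δ j e + occurrences p j) i
      ≡⟨ Ax-+ (λ j → δ j e) (occurrences p) i ⟩
    Ax G (λ j → δ j e) i + Ax G (occurrences p) i
      ≡⟨ cong₂ _+_ (trans (Ax-unit e i) (incidence-joins joins i)) (Ax-occurrences p i) ⟩
    δ i u + δ i w + (δ i w + δ i v + + 2 * inner p i)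
      ≡⟨ regroup (δ i u) (δ i w) (δ i v) (inner p i) ⟩
    δ i u + δ i v + + 2 * (δ i w + inner p i) ∎
    where regroup : ∀ x y z h → x + y + (y + z + + 2 * h) ≡ x + z + + 2 * (y + h)
          regroup = solve-∀

  sum-occurrences : ∀ {u v} (p : Walk G u v) → sumℤ (occurrences p) ≡ + walkLength G p
  sum-occurrences p = sum-count (edges G p)
    where
    sum-count : (l : List (Fin m)) → sumℤ (λ j → + count j l) ≡ + List.length l
    sum-count List.[]      = sum-zero {m}
    sum-count (e List.∷ l) = begin
      sumℤ (λ j → + count j (e List.∷ l))   ≡⟨ sum-cong (λ j → count-step j e l) ⟩
      sumℤ (λ j → δ j e + + count j l)     ≡⟨ sum-+ (λ j → δ j e) (λ j → + count j l) ⟩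
      sumℤ (λ j → δ j e) + sumℤ (λ j → + count j l)
        ≡⟨ cong₂ _+_ (trans (sum-cong (λ j → sym (ℤP.*-identityˡ (δ j e)))) (sum-δ (λ _ → + 1) e))
                     (sum-count l) ⟩
      + 1 + + List.length l                ∎

module Image {n m : ℕ} (G : Graph n m) (conn : Connected G) (r : Fin n) where
  open Incidence G
  open Walks G

  toRoot : ∀ u → Walk G u r
  toRoot u = conn u r

  superpose : (v : Fin n → Fin m → ℤ) (τ : Fin n → ℤ) →
    (∀ u i → Ax G (v u) i ≡ δ i u - τ u * δ i r) → (b : Fin n → ℤ) →
    ∀ i → Ax G (λ j → sumℤ (λ u → b u * v u j)) i ≡ b i - sumℤ (λ u → b u * τ u) * δ i r
  superpose v τ Av b i = begin
    Ax G (λ j → sumℤ (λ u → b u * v u j)) i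
      ≡⟨ Ax-sum (λ u j → b u * v u j) i ⟩
    sumℤ (λ u → Ax G (λ j → b u * v u j) i)
      ≡⟨ sum-cong (λ u → trans (Ax-scale (b u) (v u) i)
                        (trans (cong (b u *_) (Av u i)) (expand (b u) (δ i u) (τ u) (δ i r)))) ⟩
    sumℤ (λ u → b u * δ i u - δ i r * (b u * τ u))
      ≡⟨ sum-− (λ u → b u * δ i u) (λ u → δ i r * (b u * τ u)) ⟩
    sumℤ (λ u → b u * δ i u) - sumℤ (λ u → δ i r * (b u * τ u))
      ≡⟨ cong₂ _-_ (trans (sum-cong (λ u → cong (b u *_) (δ-sym i u))) (sum-δ b i))
                   (sum-scale (δ i r) (λ u → b u * τ u)) ⟩
    b i - δ i r * sumℤ (λ u → b u * τ u)
      ≡⟨ cong (_-_ (b i)) (ℤP.*-comm (δ i r) _) ⟩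
    b i - sumℤ (λ u → b u * τ u) * δ i r ∎
    where expand : ∀ x y t z → x * (y - t * z) ≡ x * y - z * (x * t)
          expand = solve-∀

  -- Either some edge joins two vertices whose walks to r have equal parity (then these walks
  -- and the edge form an odd closed walk at r), or parity of walks to r 2-colours G.
  oddClosedWalk-or-colouring :
    (Σ (Walk G r r) λ Q → parity Q ≡ true) ⊎ (∀ j → parity (toRoot (src j)) ≢ parity (toRoot (tgt j)))
  oddClosedWalk-or-colouring
    with FinP.any? (λ j → parity (toRoot (src j)) BoolP.≟ parity (toRoot (tgt j)))
  ... | no no-monochromatic-edge = inj₂ (λ j same → no-monochromatic-edge (j , same))
  ... | yes (j , same) = inj₁ (Q , odd)
    where
    Q : Walk G r r
    Q = reverse (toRoot (src j)) ++w ((j , inj₁ refl) ∷ toRoot (tgt j))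
    odd : parity Q ≡ true
    odd = begin
      parity Q
        ≡⟨ parity-++ (reverse (toRoot (src j))) ((j , inj₁ refl) ∷ toRoot (tgt j)) ⟩
      parity (reverse (toRoot (src j))) xor not (parity (toRoot (tgt j)))
        ≡⟨ cong₂ (λ s t → s xor not t) (parity-reverse (toRoot (src j))) (sym same) ⟩
      parity (toRoot (src j)) xor not (parity (toRoot (src j)))
        ≡⟨ BoolP.xor-inverseʳ (parity (toRoot (src j))) ⟩
      true ∎

  module NonBipartite (Q : Walk G r r) (Q-odd : parity Q ≡ true) where

    evenToRoot : ∀ u → Σ (Walk G u r) λ p → parity p ≡ false
    evenToRoot u with parity (toRoot u) in eq
    ... | false = toRoot u , eq
    ... | true  = toRoot u ++w Q , trans (parity-++ (toRoot u) Q) (cong₂ _xor_ eq Q-odd)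

    Ax-Q : ∀ i → Ax G (alternating Q) i ≡ + 2 * δ i r
    Ax-Q i = trans (Ax-alternating Q i) (trans (cong (λ t → δ i r - sign t * δ i r) Q-odd) (double (δ i r)))
      where double : ∀ x → x - (- + 1) * x ≡ + 2 * x
            double = solve-∀

    solve-even : (b : Fin n → ℤ) (k : ℤ) → sumℤ b ≡ + 2 * k → Solvable b
    solve-even b k Σb≡2k = (λ j → sumℤ (λ u → b u * v u j) + k * alternating Q j) , λ i → begin
      Ax G (λ j → sumℤ (λ u → b u * v u j) + k * alternating Q j) i
        ≡⟨ Ax-+ (λ j → sumℤ (λ u → b u * v u j)) (λ j → k * alternating Q j) i ⟩
      Ax G (λ j → sumℤ (λ u → b u * v u j)) i + Ax G (λ j → k * alternating Q j) i
        ≡⟨ cong₂ _+_ (superpose v (λ _ → + 1) Av b i)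
                     (trans (Ax-scale k (alternating Q) i) (cong (k *_) (Ax-Q i))) ⟩
      b i - sumℤ (λ u → b u * + 1) * δ i r + k * (+ 2 * δ i r)
        ≡⟨ cong (λ s → b i - s * δ i r + k * (+ 2 * δ i r))
                (trans (sum-cong (λ u → ℤP.*-identityʳ (b u))) Σb≡2k) ⟩
      b i - + 2 * k * δ i r + k * (+ 2 * δ i r)
        ≡⟨ cancel (b i) k (δ i r) ⟩
      b i ∎
      where
      v : Fin n → Fin m → ℤ
      v u = alternating (proj₁ (evenToRoot u))
      Av : ∀ u i → Ax G (v u) i ≡ δ i u - + 1 * δ i r
      Av u i = trans (Ax-alternating (proj₁ (evenToRoot u)) i)
                     (cong (λ t → δ i u - sign t * δ i r) (proj₂ (evenToRoot u)))
      cancel : ∀ x k y → x - + 2 * k * y + k * (+ 2 * y) ≡ x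
      cancel = solve-∀

  module Bipartite (proper : ∀ j → parity (toRoot (src j)) ≢ parity (toRoot (tgt j))) where

    colour : Fin n → ℤ
    colour u = sign (parity (toRoot u))

    colour-edge : ∀ j → colour (src j) + colour (tgt j) ≡ 0ℤ
    colour-edge j = opposite (parity (toRoot (src j))) (parity (toRoot (tgt j))) (proper j)
      where
      opposite : ∀ x y → x ≢ y → sign x + sign y ≡ 0ℤ
      opposite false false x≢y = ⊥-elim (x≢y refl)
      opposite false true  _   = refl
      opposite true  false _   = refl
      opposite true  true  x≢y = ⊥-elim (x≢y refl)

    colour-annihilates : ∀ z → sumℤ (λ u → colour u * Ax G z u) ≡ 0ℤ
    colour-annihilates z = begin
      sumℤ (λ u → colour u * Ax G z u)                  ≡⟨ Ax-dual colour z ⟩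
      sumℤ (λ j → z j * (colour (src j) + colour (tgt j)))
        ≡⟨ sum-cong (λ j → cong (z j *_) (colour-edge j)) ⟩
      sumℤ (λ j → z j * 0ℤ)
        ≡⟨ trans (sum-cong (λ j → ℤP.*-zeroʳ (z j))) (sum-zero {m}) ⟩
      0ℤ                                                ∎

    solve-balanced : (b : Fin n → ℤ) → sumℤ (λ u → b u * colour u) ≡ 0ℤ → Solvable b
    solve-balanced b balanced = (λ j → sumℤ (λ u → b u * alternating (toRoot u) j)) , λ i → begin
      Ax G (λ j → sumℤ (λ u → b u * alternating (toRoot u) j)) i
        ≡⟨ superpose (λ u → alternating (toRoot u)) colour (λ u → Ax-alternating (toRoot u)) b i ⟩
      b i - sumℤ (λ u → b u * colour u) * δ i r
        ≡⟨ cong (λ s → b i - s * δ i r) balanced ⟩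
      b i - 0ℤ * δ i r
        ≡⟨ drop (b i) (δ i r) ⟩
      b i ∎
      where drop : ∀ x y → x - 0ℤ * y ≡ x
            drop = solve-∀

module Kernels (d : ℕ) .{{_ : NonZero d}} {n m : ℕ} (G : Graph n m) where
  open Incidence G
  open Reduction d

  standardLift : (Fin m → Fin d) → Fin m → ℤ
  standardLift y j = + toℕ (y j)

  Ax-cg : ∀ {f g : Fin m → ℤ} → (∀ j → f j ≡[ d ] g j) → ∀ i → Ax G f i ≡[ d ] Ax G g i
  Ax-cg {f} {g} f≡g i = cg-sum (λ j → incidence G i j * f j) (λ j → incidence G i j * g j)
                               (λ j → cg-* (incidence G i j) (f≡g j))

  quotients : ∀ {y} → InKerMod G d y → Σ (Fin n → ℤ) λ b → ∀ i → Ax G (standardLift y) i ≡ b i * + d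
  quotients {y} y∈ker = (λ i → ℤD._∣_.quotient (divides i)) , (λ i → ℤD._∣_.equality (divides i))
    where divides : ∀ i → + d ℤD.∣ Ax G (standardLift y) i
          divides i = ℤD.∣ᵤ⇒∣ (y∈ker i)

  kernel-by-congruence : ∀ y (z : Fin m → ℤ) → (∀ j → standardLift y j ≡[ d ] z j) →
    (∀ i → Ax G z i ≡[ d ] 0ℤ) → InKerMod G d y
  kernel-by-congruence y z ŷ≡z Az≡0 i = divisible (cg-trans (Ax-cg ŷ≡z i) (Az≡0 i))
    where divisible : ∀ {a} → a ≡[ d ] 0ℤ → + d ℤU.∣ a
          divisible {a} (q , a≡qd) = ℤD.∣⇒∣ᵤ (ℤD.divides q (trans (sym (ℤP.+-identityʳ a)) a≡qd))

  kernel-reduces : ∀ y → Σ (Fin m → ℤ) (λ x → InKerℤ G x × (∀ j → πd d (x j) ≡ y j)) →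
    InKerMod G d y
  kernel-reduces y (x , Ax≡0 , x↦y) =
    kernel-by-congruence y x (λ j → reduce-from (x↦y j)) (λ i → cg-eq (Ax≡0 i))

  lift-solution : (z : Fin m → ℤ) (b : Fin n → ℤ) → (∀ i → Ax G z i ≡ b i * + d) → Solvable b →
    Σ (Fin m → ℤ) λ x → InKerℤ G x × (∀ j → x j ≡[ d ] z j)
  lift-solution z b Az (w , Aw) = (λ j → z j - + d * w j) , kernel , λ j → - w j , shift (z j) (+ d) (w j)
    where
    cancel : ∀ b d → b * d - d * b ≡ 0ℤ
    cancel = solve-∀
    shift : ∀ a d w → a - d * w - a ≡ (- w) * d
    shift = solve-∀
    kernel : InKerℤ G (λ j → z j - + d * w j)
    kernel i = begin
      Ax G (λ j → z j - + d * w j) i      ≡⟨ Ax-− z (λ j → + d * w j) i ⟩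
      Ax G z i - Ax G (λ j → + d * w j) i
        ≡⟨ cong₂ _-_ (Az i) (trans (Ax-scale (+ d) w i) (cong (+ d *_) (Aw i))) ⟩
      b i * + d - + d * b i               ≡⟨ cancel (b i) (+ d) ⟩
      0ℤ                                  ∎

  weighted-quotients : ∀ (h : Fin n → ℤ) (z : Fin m → ℤ) (b : Fin n → ℤ) →
    (∀ i → Ax G z i ≡ b i * + d) →
    sumℤ (λ u → b u * h u) * + d ≡ sumℤ (λ u → h u * Ax G z u)
  weighted-quotients h z b Az = begin
    sumℤ (λ u → b u * h u) * + d       ≡⟨ ℤP.*-comm (sumℤ (λ u → b u * h u)) (+ d) ⟩
    + d * sumℤ (λ u → b u * h u)       ≡⟨ sym (sum-scale (+ d) (λ u → b u * h u)) ⟩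
    sumℤ (λ u → + d * (b u * h u))     ≡⟨ sum-cong (λ u → trans (rearrange (+ d) (b u) (h u))
                                                                (cong (h u *_) (sym (Az u)))) ⟩
    sumℤ (λ u → h u * Ax G z u)        ∎
    where rearrange : ∀ x y t → x * (y * t) ≡ t * (y * x)
          rearrange = solve-∀

  sum-quotients : ∀ (z : Fin m → ℤ) (b : Fin n → ℤ) → (∀ i → Ax G z i ≡ b i * + d) →
    sumℤ b * + d ≡ + 2 * sumℤ z
  sum-quotients z b Az = begin
    sumℤ b * + d                       ≡⟨ cong (_* + d) (sum-cong (λ u → sym (ℤP.*-identityʳ (b u)))) ⟩
    sumℤ (λ u → b u * + 1) * + d       ≡⟨ weighted-quotients (λ _ → + 1) z b Az ⟩
    sumℤ (λ u → + 1 * Ax G z u)        ≡⟨ sum-cong (λ u → ℤP.*-identityˡ (Ax G z u)) ⟩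
    sumℤ (Ax G z)                      ≡⟨ sum-Ax z ⟩
    + 2 * sumℤ z                       ∎

empty-or-inhabited : ∀ k → (Fin k → ⊥) ⊎ Fin k
empty-or-inhabited zero    = inj₁ (λ ())
empty-or-inhabited (suc k) = inj₂ Fin.zero

module Proposition (d : ℕ) .{{_ : NonZero d}} {n m : ℕ} (G : Graph n m) (conn : Connected G) where
  open Incidence G
  open Walks G
  open Reduction d
  open Kernels d G

  quotient-solvable : (¬ 2 ∣ d ⊎ ¬ OddCycle G) → ∀ (z : Fin m → ℤ) (b : Fin n → ℤ) →
    (∀ i → Ax G z i ≡ b i * + d) → Solvable b
  quotient-solvable hyp z b Az with empty-or-inhabited n
  ... | inj₁ no-vertex = (λ _ → 0ℤ) , λ i → ⊥-elim (no-vertex i)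
  ... | inj₂ r with Image.oddClosedWalk-or-colouring G conn r
  ...   | inj₂ proper = solve-balanced b (ℤP.*-cancelʳ-≡ _ 0ℤ (+ d) (begin
            sumℤ (λ u → b u * colour u) * + d   ≡⟨ weighted-quotients colour z b Az ⟩
            sumℤ (λ u → colour u * Ax G z u)    ≡⟨ colour-annihilates z ⟩
            0ℤ                                  ≡⟨ sym (ℤP.*-zeroˡ (+ d)) ⟩
            0ℤ * + d                            ∎))
    where open Image.Bipartite G conn r proper
  ...   | inj₁ (Q , Q-odd) with hyp
  ...     | inj₂ no-odd-cycle = ⊥-elim (no-odd-cycle (r , Q , parity⇒odd Q Q-odd))
  ...     | inj₁ d-odd = Image.NonBipartite.solve-even G conn r Q Q-odd b (proj₁ Σb-even) (proj₂ Σb-even)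
    where Σb-even = even-factor d-odd (sumℤ b) (sumℤ z) (sum-quotients z b Az)

  kernel-lifts : (¬ 2 ∣ d ⊎ ¬ OddCycle G) → ∀ y → InKerMod G d y →
    Σ (Fin m → ℤ) (λ x → InKerℤ G x × (∀ j → πd d (x j) ≡ y j))
  kernel-lifts hyp y y∈ker with quotients y∈ker
  ... | b , Aŷ with lift-solution (standardLift y) b Aŷ (quotient-solvable hyp (standardLift y) b Aŷ)
  ...   | x , Ax≡0 , x≡ŷ = x , Ax≡0 , λ j → reduce-to (x≡ŷ j)

  module OddCycle (two : 2 ∣ d) (v : Fin n) (C : Walk G v v) (C-odd : ¬ 2 ∣ walkLength G C) where
    open Image.NonBipartite G conn v C (odd⇒parity C C-odd) using (solve-even)

    half : ℤ
    half = + (d ℕ./ 2)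

    half*2≡d : half * + 2 ≡ + d
    half*2≡d = trans (sym (ℤP.pos-* (d ℕ./ 2) 2)) (cong +_ (ℕDM.m/n*n≡m two))

    L : ℕ
    L = walkLength G C

    L-odd : Σ ℕ λ l → + L ≡ + 2 * + l + + 1
    L-odd = odd-ℕ L C-odd

    visits : Fin n → ℤ
    visits i = δ i v + inner C i

    Ax-ω : ∀ i → Ax G (ω G d C) i ≡ visits i * + d
    Ax-ω i = begin
      Ax G (ω G d C) i                        ≡⟨ Ax-scale half (occurrences C) i ⟩
      half * Ax G (occurrences C) i           ≡⟨ cong (half *_) (Ax-occurrences C i) ⟩
      half * (δ i v + δ i v + + 2 * inner C i) ≡⟨ regroup half (δ i v) (inner C i) ⟩
      visits i * (half * + 2)                 ≡⟨ cong (visits i *_) half*2≡d ⟩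
      visits i * + d                          ∎
      where regroup : ∀ h x y → h * (x + x + + 2 * y) ≡ (x + y) * (h * + 2)
            regroup = solve-∀

    -- A closed walk visits vertices as often as it has edges; here an odd number of times.
    sum-visits : sumℤ visits ≡ + L
    sum-visits = ℤP.*-cancelˡ-≡ (+ 2) (sumℤ visits) (+ L) (begin
      + 2 * sumℤ visits                   ≡⟨ sym (sum-scale (+ 2) visits) ⟩
      sumℤ (λ i → + 2 * visits i)
        ≡⟨ sum-cong (λ i → sym (trans (Ax-occurrences C i) (double (δ i v) (inner C i)))) ⟩
      sumℤ (Ax G (occurrences C))         ≡⟨ sum-Ax (occurrences C) ⟩
      + 2 * sumℤ (occurrences C)          ≡⟨ cong (+ 2 *_) (sum-occurrences C) ⟩
      + 2 * + L                           ∎)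
      where double : ∀ x y → x + x + + 2 * y ≡ + 2 * (x + y)
            double = solve-∀

    sum-ω-nonzero : ¬ (sumℤ (ω G d C) ≡[ d ] 0ℤ)
    sum-ω-nonzero (q , Σω≡qd) with L-odd
    ... | l , L≡2l+1 = odd≢even (+ l) q (trans (sym L≡2l+1) (ℤP.*-cancelʳ-≡ (+ L) (+ 2 * q) (+ d) (begin
      + L * + d                         ≡⟨ cong (+ L *_) (sym half*2≡d) ⟩
      + L * (half * + 2)                ≡⟨ rearrange (+ L) half ⟩
      + 2 * (half * + L - 0ℤ)           ≡⟨ cong (λ t → + 2 * (half * t - 0ℤ)) (sym (sum-occurrences C)) ⟩
      + 2 * (half * sumℤ (occurrences C) - 0ℤ)
        ≡⟨ cong (λ t → + 2 * (t - 0ℤ)) (sym (sum-scale half (occurrences C))) ⟩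
      + 2 * (sumℤ (ω G d C) - 0ℤ)       ≡⟨ cong (+ 2 *_) Σω≡qd ⟩
      + 2 * (q * + d)                   ≡⟨ sym (ℤP.*-assoc (+ 2) q (+ d)) ⟩
      + 2 * q * + d                     ∎)))
      where rearrange : ∀ l h → l * (h * + 2) ≡ + 2 * (h * l - 0ℤ)
            rearrange = solve-∀

    ω-even-multiple : ∀ k j → (+ 2 * k) * ω G d C j ≡[ d ] 0ℤ
    ω-even-multiple k j = k * occurrences C j ,
      trans (rearrange k half (occurrences C j)) (cong (k * occurrences C j *_) half*2≡d)
      where rearrange : ∀ k h o → (+ 2 * k) * (h * o) - 0ℤ ≡ k * o * (h * + 2)
            rearrange = solve-∀

    ω-odd-multiple : ∀ k j → (+ 2 * k + + 1) * ω G d C j ≡[ d ] ω G d C j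
    ω-odd-multiple k j = k * occurrences C j ,
      trans (rearrange k half (occurrences C j)) (cong (k * occurrences C j *_) half*2≡d)
      where rearrange : ∀ k h o → (+ 2 * k + + 1) * (h * o) - h * o ≡ k * o * (h * + 2)
            rearrange = solve-∀

    Decomposed : (Fin m → Fin d) → Set
    Decomposed y = Σ (Fin m → ℤ) λ x → InKerℤ G x × Σ ℤ λ c →
      ∀ j → y j ≡ addMod d (πd d (x j)) (smulMod d c (πd d (ω G d C j)))

    decompose-via : ∀ y (c : ℤ) (z : Fin m → ℤ) (b : Fin n → ℤ) →
      (∀ j → standardLift y j ≡ z j + c * ω G d C j) → (∀ i → Ax G z i ≡ b i * + d) → Solvable b →
      Decomposed y
    decompose-via y c z b ŷ≡z+cω Az b-solvable with lift-solution z b Az b-solvable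
    ... | x , Ax≡0 , x≡z = x , Ax≡0 , c , λ j → sym (trans (reduce-affine (x j) c (ω G d C j))
            (reduce-to (cg-trans (cg-+ (x≡z j) (cg-refl (c * ω G d C j))) (cg-eq (sym (ŷ≡z+cω j))))))

    -- ker_{ℤ_d} ⊆ πd(ker_ℤ) + ⟨πd ω⟩: subtract ω when the quotient vector has odd sum.
    decompose : ∀ y → InKerMod G d y → Decomposed y
    decompose y y∈ker with quotients y∈ker
    ... | b , Aŷ with ℤ-parity (sumℤ b)
    ...   | inj₁ (k , Σb≡2k) = decompose-via y 0ℤ (standardLift y) b
            (λ j → sym (no-ω (standardLift y j) (ω G d C j))) Aŷ (solve-even b k Σb≡2k)
      where no-ω : ∀ a e → a + 0ℤ * e ≡ a
            no-ω = solve-∀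
    ...   | inj₂ (k , Σb≡2k+1) with L-odd
    ...     | l , L≡2l+1 = decompose-via y (+ 1) (λ j → standardLift y j - ω G d C j) (λ i → b i - visits i)
              (λ j → restore (standardLift y j) (ω G d C j))
              (λ i → trans (Ax-− (standardLift y) (ω G d C) i)
                     (trans (cong₂ _-_ (Aŷ i) (Ax-ω i)) (factor (b i) (visits i) (+ d))))
              (solve-even (λ i → b i - visits i) (k - + l) (begin
                 sumℤ (λ i → b i - visits i)       ≡⟨ sum-− b visits ⟩
                 sumℤ b - sumℤ visits              ≡⟨ cong₂ _-_ Σb≡2k+1 (trans sum-visits L≡2l+1) ⟩
                 + 2 * k + + 1 - (+ 2 * + l + + 1)  ≡⟨ difference k (+ l) ⟩
                 + 2 * (k - + l)                   ∎))
      where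
      restore : ∀ a e → a ≡ a - e + + 1 * e
      restore = solve-∀
      factor : ∀ b h d → b * d - h * d ≡ (b - h) * d
      factor = solve-∀
      difference : ∀ k l → + 2 * k + + 1 - (+ 2 * l + + 1) ≡ + 2 * (k - l)
      difference = solve-∀

    -- πd(ker_ℤ) + ⟨πd ω⟩ ⊆ ker_{ℤ_d}, since A ω = d·visits.
    recompose : ∀ y → Decomposed y → InKerMod G d y
    recompose y (x , Ax≡0 , c , y≡) = kernel-by-congruence y (λ j → x j + c * ω G d C j)
      (λ j → reduce-from (sym (trans (y≡ j) (reduce-affine (x j) c (ω G d C j)))))
      (λ i → c * visits i , (begin
        Ax G (λ j → x j + c * ω G d C j) i - 0ℤ
          ≡⟨ cong (_- 0ℤ) (Ax-+ x (λ j → c * ω G d C j) i) ⟩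
        Ax G x i + Ax G (λ j → c * ω G d C j) i - 0ℤ
          ≡⟨ cong₂ (λ s t → s + t - 0ℤ) (Ax≡0 i)
                   (trans (Ax-scale c (ω G d C) i) (cong (c *_) (Ax-ω i))) ⟩
        0ℤ + c * (visits i * + d) - 0ℤ
          ≡⟨ regroup c (visits i) (+ d) ⟩
        c * visits i * + d ∎))
      where regroup : ∀ c h d → 0ℤ + c * (h * d) - 0ℤ ≡ c * h * d
            regroup = solve-∀

    independent : ∀ (z : Fin m → Fin d) →
      Σ (Fin m → ℤ) (λ x → InKerℤ G x × (∀ j → πd d (x j) ≡ z j)) →
      Σ ℤ (λ c → ∀ j → z j ≡ smulMod d c (πd d (ω G d C j))) →
      ∀ j → z j ≡ zeroMod d
    independent z (x , Ax≡0 , x↦z) (c , z≡cω) with ℤ-parity c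
    ... | inj₁ (k , c≡2k) = λ j → trans (z≡cω j) (trans (reduce-scale c (ω G d C j))
            (reduce-cong (subst (λ t → t * ω G d C j ≡[ d ] 0ℤ) (sym c≡2k) (ω-even-multiple k j))))
    ... | inj₂ (k , c≡2k+1) = ⊥-elim (sum-ω-nonzero (cg-trans (cg-sym (cg-sum x (ω G d C) x≡ω))
                                                               (cg-eq (sum-kernel x Ax≡0))))
      where
      x≡ω : ∀ j → x j ≡[ d ] ω G d C j
      x≡ω j = cg-trans (cg-sym (reduce-from (x↦z j)))
        (cg-trans (reduce-from (sym (trans (z≡cω j) (reduce-scale c (ω G d C j)))))
          (subst (λ t → t * ω G d C j ≡[ d ] ω G d C j) (sym c≡2k+1) (ω-odd-multiple k j)))

proposition1 : (d n m : ℕ) .{{_ : NonZero d}} (G : Graph n m) → Connected G →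
    ((¬ (2 ∣ d) ⊎ ¬ OddCycle G) →
      ∀ (y : Fin m → Fin d) →
        InKerMod G d y ⇔ Σ (Fin m → ℤ) (λ x → InKerℤ G x × (∀ j → πd d (x j) ≡ y j)))
    × (2 ∣ d → ∀ v (C : Walk G v v) → ¬ (2 ∣ walkLength G C) →
        ((∀ (y : Fin m → Fin d) →
            InKerMod G d y
              ⇔ Σ (Fin m → ℤ) (λ x → InKerℤ G x × Σ ℤ (λ c →
                  ∀ j → y j ≡ addMod d (πd d (x j)) (smulMod d c (πd d (ω G d C j)))))))
        × (∀ (z : Fin m → Fin d) →
            Σ (Fin m → ℤ) (λ x → InKerℤ G x × (∀ j → πd d (x j) ≡ z j)) →
            Σ ℤ (λ c → ∀ j → z j ≡ smulMod d c (πd d (ω G d C j))) →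
            ∀ j → z j ≡ zeroMod d))
proposition1 d n m G conn =
  (λ hyp y → mk⇔ (kernel-lifts hyp y) (kernel-reduces y)) ,
  (λ two v C C-odd → let open OddCycle two v C C-odd in
     (λ y → mk⇔ (decompose y) (recompose y)) , independent)
  where
  open Kernels d G using (kernel-reduces)
  open Proposition d G conn
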